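{- Let $C_{n+1}$ be the set of $(n+1)$-cycles in $S_{n+1}$. There is a bijection $F:C_{n+1}\to S_n$ such that for each $\pi\in C_{n+1}$ and each $\ell\in[n]$, ${\rm Exc}(\pi)=[\ell]$ if and only if ${\rm DesBot}(F(\pi))=[\ell-1]$.
   Context: For a permutation $\pi$, ${\rm Exc}(\pi)=\{i:\pi(i)>i\}$ is its excedance set. For $p\in S_n$, ${\rm DesBot}(p)=\{p(i): 2\le i\le n,\ p(i)<p(i-1)\}$ is its descent bottoms set. $[m]=\{1,\dots,m\}$, with $[0]=\emptyset$. -}

module Defs where

open import Level using (0ℓ)
open import Data.Nat using (ℕ; zero; suc; _≤_; _<_; _∸_)
open import Data.Fin using (Fin; toℕ)
open import Data.Fin.Permutation using (Permutation′; _⟨$⟩ʳ_)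
open import Data.Product using (Σ; ∃; _×_; proj₁)
open import Function.Base using (_∘_)
open import Function.Bundles using (_⇔_)
open import Relation.Binary.Bundles using (Setoid)
open import Relation.Binary.PropositionalEquality using (_≡_; refl; sym; trans)

-- S_m : permutations of Fin m (Fin m = {0,…,m-1} encodes {1,…,m} via i ↦ toℕ i + 1)
Perm : ℕ → Set
Perm m = Permutation′ m

iter : ∀ {m} → Perm m → ℕ → Fin m → Fin m
iter π zero    i = i
iter π (suc k) i = π ⟨$⟩ʳ (iter π k i)

IsFullCycle : ∀ {m} → Perm m → Set
IsFullCycle {m} π = ∀ (i j : Fin m) → ∃ λ (k : ℕ) → iter π k i ≡ j

Cycle : ℕ → Set
Cycle m = Σ (Perm m) IsFullCycle

_≈ₚ_ : ∀ {m} → Perm m → Perm m → Set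
π ≈ₚ σ = ∀ i → π ⟨$⟩ʳ i ≡ σ ⟨$⟩ʳ i

PermSetoid : ℕ → Setoid 0ℓ 0ℓ
PermSetoid m = record
  { Carrier = Perm m
  ; _≈_ = _≈ₚ_
  ; isEquivalence = record
    { refl = λ i → refl
    ; sym = λ p i → sym (p i)
    ; trans = λ p q i → trans (p i) (q i) } }

CycleSetoid : ℕ → Setoid 0ℓ 0ℓ
CycleSetoid m = record
  { Carrier = Cycle m
  ; _≈_ = λ c d → proj₁ c ≈ₚ proj₁ d
  ; isEquivalence = record
    { refl = λ i → refl
    ; sym = λ p i → sym (p i)
    ; trans = λ p q i → trans (p i) (q i) } }

SubsetP : ℕ → Set₁
SubsetP m = Fin m → Set

Interval : ∀ {m} → ℕ → SubsetP m
Interval ℓ i = suc (toℕ i) ≤ ℓ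

_≐_ : ∀ {m} → SubsetP m → SubsetP m → Set
A ≐ B = ∀ i → A i ⇔ B i

Exc : ∀ {m} → Perm m → SubsetP m
Exc π i = toℕ i < toℕ (π ⟨$⟩ʳ i)

DesBot : ∀ {m} → Perm m → SubsetP m
DesBot {m} p v = ∃ λ (i : Fin m) → ∃ λ (j : Fin m) →
  (toℕ j ≡ suc (toℕ i)) × (p ⟨$⟩ʳ j ≡ v) × (toℕ (p ⟨$⟩ʳ j) < toℕ (p ⟨$⟩ʳ i))

-- An (n+1)-cycle π on {0,…,n} is recorded by its orbit of 0,
-- 0 → π(0) → π²(0) → … → πⁿ(0) → 0, in which the points πᵗ(0), 1 ≤ t ≤ n,
-- are exactly the nonzero points.  Reading them backwards and subtracting one
-- gives the word F(π) = (πⁿ(0)−1, …, π(0)−1) ∈ S_n.  Consecutive letters of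
-- F(π) are π-successive points, and the first letter plus one is sent to 0,
-- so v is a descent bottom of F(π) exactly when v+1 is an excedance of π;
-- besides, 0 is always an excedance when n ≥ 1.  Thus Exc(π) is {0} together
-- with DesBot(F π) shifted up by one, which gives Exc(π) = [ℓ] ⇔ DesBot(F π) = [ℓ−1].

module Submission where

open import Defs
open import Data.Nat using (ℕ; suc; _≤_; _∸_)
open import Data.Product using (∃; _×_; proj₁)
open import Function.Bundles using (Bijection; _⇔_)
open import Data.Nat using (zero; _+_; _*_; _<_; z≤n; s≤s; s≤s⁻¹; NonZero; >-nonZero; _%_; _/_; _≟_)
open import Data.Nat.Properties
open import Data.Nat.DivMod using (m≡m%n+[m/n]*n; m%n<n)
open import Data.Fin using (Fin; toℕ; fromℕ<; fromℕ; inject₁; lower₁; opposite) renaming (suc to fsuc)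
open import Data.Fin.Patterns using (0F)
open import Data.Fin.Properties
  using (toℕ-injective; toℕ<n; toℕ-fromℕ<; toℕ-fromℕ; toℕ-inject₁; toℕ-lower₁; pigeonhole; opposite-prop; opposite-involutive)
  renaming (suc-injective to fsuc-injective)
open import Data.Fin.Permutation using (_⟨$⟩ʳ_; _⟨$⟩ˡ_; inverseˡ; inverseʳ; permutation; remove; lift₀; reverse; flip; _∘ₚ_; lift₀-remove)
open import Data.Product using (_,_; proj₂)
open import Data.Sum using (_⊎_; inj₁; inj₂)
open import Data.Empty using (⊥-elim)
open import Function.Base using (_∘_)
open import Function.Bundles using (mk⇔; Equivalence)
open import Function.Properties.Equivalence using () renaming (sym to ⇔-sym; trans to ⇔-trans)
open import Relation.Nullary using (¬_; yes; no; contradiction)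
open import Relation.Binary using (tri<; tri≈; tri>)
open import Relation.Binary.PropositionalEquality
open ≡-Reasoning

module Iterate {m : ℕ} (π : Perm m) where

  iter-+ : ∀ a b x → iter π (a + b) x ≡ iter π a (iter π b x)
  iter-+ zero    b x = refl
  iter-+ (suc a) b x = cong (π ⟨$⟩ʳ_) (iter-+ a b x)

  iter-injective : ∀ k {x y} → iter π k x ≡ iter π k y → x ≡ y
  iter-injective zero    eq = eq
  iter-injective (suc k) {x} {y} eq = iter-injective k (begin
    iter π k x                   ≡⟨ inverseˡ π ⟨
    π ⟨$⟩ˡ (π ⟨$⟩ʳ iter π k x)   ≡⟨ cong (π ⟨$⟩ˡ_) eq ⟩
    π ⟨$⟩ˡ (π ⟨$⟩ʳ iter π k y)   ≡⟨ inverseˡ π ⟩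
    iter π k y                   ∎)

  iter-multiple : ∀ d x → iter π d x ≡ x → ∀ q → iter π (q * d) x ≡ x
  iter-multiple d x fix zero    = refl
  iter-multiple d x fix (suc q) = begin
    iter π (d + q * d) x        ≡⟨ iter-+ d (q * d) x ⟩
    iter π d (iter π (q * d) x) ≡⟨ cong (iter π d) (iter-multiple d x fix q) ⟩
    iter π d x                  ≡⟨ fix ⟩
    x                           ∎

  iter-mod : ∀ d .{{_ : NonZero d}} x → iter π d x ≡ x → ∀ k → iter π k x ≡ iter π (k % d) x
  iter-mod d x fix k = begin
    iter π k x                               ≡⟨ cong (λ t → iter π t x) (m≡m%n+[m/n]*n k d) ⟩
    iter π (k % d + (k / d) * d) x           ≡⟨ iter-+ (k % d) ((k / d) * d) x ⟩
    iter π (k % d) (iter π ((k / d) * d) x)  ≡⟨ cong (iter π (k % d)) (iter-multiple d x fix (k / d)) ⟩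
    iter π (k % d) x                         ∎

iter-cong : ∀ {m} {π σ : Perm m} → π ≈ₚ σ → ∀ k x → iter π k x ≡ iter σ k x
iter-cong π≈σ zero    x = refl
iter-cong {π = π} π≈σ (suc k) x = trans (cong (π ⟨$⟩ʳ_) (iter-cong π≈σ k x)) (π≈σ _)

-- A full cycle coincides with any permutation having the same orbit through
-- one point, since every point lies on that orbit.
orbit-determines : ∀ {m} (π σ : Perm m) → IsFullCycle π →
  ∀ x₀ → (∀ t → iter π t x₀ ≡ iter σ t x₀) → π ≈ₚ σ
orbit-determines π σ full x₀ same x = begin
  π ⟨$⟩ʳ x                  ≡⟨ cong (π ⟨$⟩ʳ_) reach ⟨
  iter π (suc k) x₀         ≡⟨ same (suc k) ⟩
  σ ⟨$⟩ʳ iter σ k x₀        ≡⟨ cong (σ ⟨$⟩ʳ_) (same k) ⟨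
  σ ⟨$⟩ʳ iter π k x₀        ≡⟨ cong (σ ⟨$⟩ʳ_) reach ⟩
  σ ⟨$⟩ʳ x                  ∎
  where
    k = proj₁ (full x₀ x)
    reach = proj₂ (full x₀ x)

first-or-successor : ∀ {m} (j : Fin m) → toℕ j ≡ 0 ⊎ ∃ λ (i : Fin m) → toℕ j ≡ suc (toℕ i)
first-or-successor 0F       = inj₁ refl
first-or-successor (fsuc i) = inj₂ (inject₁ i , cong suc (sym (toℕ-inject₁ i)))

∸-opposite : ∀ {n} (x : Fin n) → n ∸ toℕ (opposite x) ≡ suc (toℕ x)
∸-opposite {n} x = trans (cong (n ∸_) (opposite-prop x)) (m∸[m∸n]≡n (toℕ<n x))

module FullCycle {n : ℕ} (π : Perm (suc n)) (full : IsFullCycle π) where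
  open Iterate π

  orbit : ℕ → Fin (suc n)
  orbit t = iter π t 0F

  orbit-return : ∀ {a b} → a ≤ b → orbit a ≡ orbit b → orbit (b ∸ a) ≡ 0F
  orbit-return {a} {b} a≤b eq = sym (iter-injective a (begin
    orbit a                   ≡⟨ eq ⟩
    orbit b                   ≡⟨ cong orbit (m+[n∸m]≡n a≤b) ⟨
    orbit (a + (b ∸ a))       ≡⟨ iter-+ a (b ∸ a) 0F ⟩
    iter π a (orbit (b ∸ a))  ∎))

  reach-within : ∀ d .{{_ : NonZero d}} → orbit d ≡ 0F → ∀ y → ∃ λ (r : Fin d) → orbit (toℕ r) ≡ y
  reach-within d ret y = fromℕ< (m%n<n k d) , (begin
    orbit (toℕ (fromℕ< (m%n<n k d)))  ≡⟨ cong orbit (toℕ-fromℕ< (m%n<n k d)) ⟩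
    orbit (k % d)                     ≡⟨ iter-mod d 0F ret k ⟨
    orbit k                           ≡⟨ proj₂ (full 0F y) ⟩
    y                                 ∎)
    where k = proj₁ (full 0F y)

  -- the orbit cannot return to 0 in d ≤ n steps: the n+1 points would then
  -- inject into d step counts (pigeonhole)
  period-bound : ∀ d → 0 < d → orbit d ≡ 0F → suc n ≤ d
  period-bound d 0<d ret = ≮⇒≥ too-short
    where
      instance
        d≢0 : NonZero d
        d≢0 = >-nonZero 0<d
      steps : Fin (suc n) → Fin d
      steps y = proj₁ (reach-within d ret y)
      steps-injective : ∀ {y z} → steps y ≡ steps z → y ≡ z
      steps-injective {y} {z} eq = begin
        y                   ≡⟨ proj₂ (reach-within d ret y) ⟨
        orbit (toℕ (steps y)) ≡⟨ cong (orbit ∘ toℕ) eq ⟩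
        orbit (toℕ (steps z)) ≡⟨ proj₂ (reach-within d ret z) ⟩
        z                   ∎
      too-short : ¬ d < suc n
      too-short d<n with i , j , i<j , eq ← pigeonhole d<n steps =
        <-irrefl (cong toℕ (steps-injective eq)) i<j

  collision-gap : ∀ {a b} → a < b → b ≤ suc n → orbit a ≡ orbit b → b ∸ a ≡ suc n
  collision-gap {a} {b} a<b b≤m eq = ≤-antisym (≤-trans (m∸n≤m b a) b≤m)
    (period-bound (b ∸ a) (m<n⇒0<n∸m a<b) (orbit-return (<⇒≤ a<b) eq))

  orbit-period : orbit (suc n) ≡ 0F
  orbit-period with i , j , i<j , eq ← pigeonhole (n<1+n (suc n)) (orbit ∘ toℕ) =
    subst (λ t → orbit t ≡ 0F) (collision-gap i<j (s≤s⁻¹ (toℕ<n j)) eq) (orbit-return (<⇒≤ i<j) eq)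

  orbit-mod : ∀ t → orbit t ≡ orbit (t % suc n)
  orbit-mod = iter-mod (suc n) 0F orbit-period

  orbit-injective : ∀ {a b} → a < suc n → b < suc n → orbit a ≡ orbit b → a ≡ b
  orbit-injective {a} {b} a<m b<m eq with <-cmp a b
  ... | tri< a<b _ _ = ⊥-elim (<-irrefl (collision-gap a<b (<⇒≤ b<m) eq) (≤-<-trans (m∸n≤m b a) b<m))
  ... | tri≈ _ a≡b _ = a≡b
  ... | tri> _ _ b<a = ⊥-elim (<-irrefl (collision-gap b<a (<⇒≤ a<m) (sym eq)) (≤-<-trans (m∸n≤m a b) a<m))

  -- the orbit listed as a permutation t ↦ πᵗ(0) of Fin (suc n); it fixes 0
  orbitIndex : Fin (suc n) → Fin (suc n)
  orbitIndex y = proj₁ (reach-within (suc n) orbit-period y)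

  orbit-orbitIndex : ∀ y → orbit (toℕ (orbitIndex y)) ≡ y
  orbit-orbitIndex y = proj₂ (reach-within (suc n) orbit-period y)

  orbitIndex-orbit : ∀ t → orbitIndex (orbit (toℕ t)) ≡ t
  orbitIndex-orbit t = toℕ-injective
    (orbit-injective (toℕ<n (orbitIndex (orbit (toℕ t)))) (toℕ<n t) (orbit-orbitIndex (orbit (toℕ t))))

  orbitPerm : Perm (suc n)
  orbitPerm = permutation (orbit ∘ toℕ) orbitIndex orbit-orbitIndex orbitIndex-orbit

  -- F(π): the orbit without its initial 0, read backwards and shifted down by one
  word : Perm n
  word = reverse ∘ₚ remove 0F orbitPerm

  word-orbit : ∀ k → fsuc (word ⟨$⟩ʳ k) ≡ orbit (n ∸ toℕ k)
  word-orbit k = begin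
    fsuc (word ⟨$⟩ʳ k)                 ≡⟨ lift₀-remove orbitPerm refl (fsuc (opposite k)) ⟩
    orbit (suc (toℕ (opposite k)))     ≡⟨ cong (orbit ∘ suc) (opposite-prop k) ⟩
    orbit (suc (n ∸ suc (toℕ k)))      ≡⟨ cong orbit (+-∸-assoc 1 (toℕ<n k)) ⟨
    orbit (n ∸ toℕ k)                  ∎

  orbit-letter : ∀ {t} (t<n : t < n) → orbit (suc t) ≡ fsuc (word ⟨$⟩ʳ opposite (fromℕ< t<n))
  orbit-letter {t} t<n = begin
    orbit (suc t)                         ≡⟨ cong (orbit ∘ suc) (toℕ-fromℕ< t<n) ⟨
    orbit (suc (toℕ (fromℕ< t<n)))        ≡⟨ cong orbit (∸-opposite (fromℕ< t<n)) ⟨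
    orbit (n ∸ toℕ (opposite (fromℕ< t<n))) ≡⟨ word-orbit (opposite (fromℕ< t<n)) ⟨
    fsuc (word ⟨$⟩ʳ opposite (fromℕ< t<n)) ∎

  word-step : ∀ {i j} → toℕ j ≡ suc (toℕ i) → π ⟨$⟩ʳ fsuc (word ⟨$⟩ʳ j) ≡ fsuc (word ⟨$⟩ʳ i)
  word-step {i} {j} j≡i+1 = begin
    π ⟨$⟩ʳ fsuc (word ⟨$⟩ʳ j)        ≡⟨ cong (π ⟨$⟩ʳ_) (word-orbit j) ⟩
    orbit (suc (n ∸ toℕ j))          ≡⟨ cong (λ t → orbit (suc (n ∸ t))) j≡i+1 ⟩
    orbit (suc (n ∸ suc (toℕ i)))    ≡⟨ cong orbit (+-∸-assoc 1 (toℕ<n i)) ⟨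
    orbit (n ∸ toℕ i)                ≡⟨ word-orbit i ⟨
    fsuc (word ⟨$⟩ʳ i)               ∎

  word-first : ∀ j → toℕ j ≡ 0 → π ⟨$⟩ʳ fsuc (word ⟨$⟩ʳ j) ≡ 0F
  word-first j j≡0 = begin
    π ⟨$⟩ʳ fsuc (word ⟨$⟩ʳ j)   ≡⟨ cong (π ⟨$⟩ʳ_) (word-orbit j) ⟩
    orbit (suc (n ∸ toℕ j))     ≡⟨ cong (λ t → orbit (suc (n ∸ t))) j≡0 ⟩
    orbit (suc n)               ≡⟨ orbit-period ⟩
    0F                          ∎

  descent⇔exc : ∀ {i j} → toℕ j ≡ suc (toℕ i) →
    (toℕ (word ⟨$⟩ʳ j) < toℕ (word ⟨$⟩ʳ i)) ⇔ Exc π (fsuc (word ⟨$⟩ʳ j))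
  descent⇔exc {i} {j} j≡i+1 =
    subst (λ y → (toℕ (word ⟨$⟩ʳ j) < toℕ (word ⟨$⟩ʳ i)) ⇔ (suc (toℕ (word ⟨$⟩ʳ j)) < toℕ y))
      (sym (word-step j≡i+1)) (mk⇔ s≤s s≤s⁻¹)

  -- the first letter plus one is sent to 0, so it is not an excedance
  first-not-exc : ∀ j → toℕ j ≡ 0 → ¬ Exc π (fsuc (word ⟨$⟩ʳ j))
  first-not-exc j j≡0 exc = n≮0 (subst (λ y → suc (toℕ (word ⟨$⟩ʳ j)) < toℕ y) (word-first j j≡0) exc)

  desBot⇒exc : ∀ v → DesBot word v → Exc π (fsuc v)
  desBot⇒exc v (i , j , j≡i+1 , refl , descent) = Equivalence.to (descent⇔exc j≡i+1) descent

  -- an excedance at a letter plus one cannot be at the first position, so the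
  -- letter follows another one and is a descent bottom
  exc⇒desBot-at : ∀ j → toℕ j ≡ 0 ⊎ (∃ λ i → toℕ j ≡ suc (toℕ i)) →
    Exc π (fsuc (word ⟨$⟩ʳ j)) → DesBot word (word ⟨$⟩ʳ j)
  exc⇒desBot-at j (inj₁ j≡0)         exc = contradiction exc (first-not-exc j j≡0)
  exc⇒desBot-at j (inj₂ (i , j≡i+1)) exc = i , j , j≡i+1 , refl , Equivalence.from (descent⇔exc j≡i+1) exc

  desBot⇔exc : ∀ v → DesBot word v ⇔ Exc π (fsuc v)
  desBot⇔exc v = mk⇔ (desBot⇒exc v) (λ exc →
    subst (DesBot word) (inverseʳ word)
      (exc⇒desBot-at j (first-or-successor j) (subst (Exc π ∘ fsuc) (sym (inverseʳ word)) exc)))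
    where j = word ⟨$⟩ˡ v

  -- 0 is an excedance once n ≥ 1, because π(0) = 0 would be a return after one step
  exc-zero : 0 < n → Exc π 0F
  exc-zero 0<n with π ⟨$⟩ʳ 0F in π0≡
  ... | 0F     = contradiction (period-bound 1 (s≤s z≤n) π0≡) (<⇒≱ (s≤s 0<n))
  ... | fsuc _ = s≤s z≤n

F : ∀ {n} → Cycle (suc n) → Perm n
F (π , full) = FullCycle.word π full

F-cong : ∀ {n} (x y : Cycle (suc n)) → proj₁ x ≈ₚ proj₁ y → F x ≈ₚ F y
F-cong {n} (π , f) (σ , g) π≈σ k = fsuc-injective (begin
  fsuc (F (π , f) ⟨$⟩ʳ k)   ≡⟨ FullCycle.word-orbit π f k ⟩
  iter π (n ∸ toℕ k) 0F     ≡⟨ iter-cong π≈σ (n ∸ toℕ k) 0F ⟩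
  iter σ (n ∸ toℕ k) 0F     ≡⟨ FullCycle.word-orbit σ g k ⟨
  fsuc (F (σ , g) ⟨$⟩ʳ k)   ∎)

-- the word determines the orbit of 0, hence the cycle
F-injective : ∀ {n} (x y : Cycle (suc n)) → F x ≈ₚ F y → proj₁ x ≈ₚ proj₁ y
F-injective {n} (π , f) (σ , g) same = orbit-determines π σ f 0F orbits-agree
  where
    module X = FullCycle π f
    module Y = FullCycle σ g
    first-orbits-agree : ∀ t → t < suc n → X.orbit t ≡ Y.orbit t
    first-orbits-agree zero    _         = refl
    first-orbits-agree (suc t) (s≤s t<n) = begin
      X.orbit (suc t)                               ≡⟨ X.orbit-letter t<n ⟩
      fsuc (X.word ⟨$⟩ʳ opposite (fromℕ< t<n))      ≡⟨ cong fsuc (same (opposite (fromℕ< t<n))) ⟩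
      fsuc (Y.word ⟨$⟩ʳ opposite (fromℕ< t<n))      ≡⟨ Y.orbit-letter t<n ⟨
      Y.orbit (suc t)                               ∎
    orbits-agree : ∀ t → X.orbit t ≡ Y.orbit t
    orbits-agree t = begin
      X.orbit t               ≡⟨ X.orbit-mod t ⟩
      X.orbit (t % suc n)     ≡⟨ first-orbits-agree (t % suc n) (m%n<n t (suc n)) ⟩
      Y.orbit (t % suc n)     ≡⟨ Y.orbit-mod t ⟨
      Y.orbit t               ∎

-- The rotation i ↦ i + 1 (mod n+1) of Fin (suc n), with inverse i ↦ i − 1.
rotate : ∀ {n} → Fin (suc n) → Fin (suc n)
rotate {n} j with n ≟ toℕ j
... | yes _   = 0F
... | no j≢n  = fsuc (lower₁ j j≢n)

unrotate : ∀ {n} → Fin (suc n) → Fin (suc n)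
unrotate {n} 0F = fromℕ n
unrotate (fsuc i) = inject₁ i

rotate-unrotate : ∀ {n} (y : Fin (suc n)) → rotate (unrotate y) ≡ y
rotate-unrotate {n} 0F with n ≟ toℕ (fromℕ n)
... | yes _   = refl
... | no n≢n  = contradiction (sym (toℕ-fromℕ n)) n≢n
rotate-unrotate {n} (fsuc i) with n ≟ toℕ (inject₁ i)
... | yes n≡i = contradiction (toℕ<n i) (<-irrefl (sym (trans n≡i (toℕ-inject₁ i))))
... | no n≢i  = cong fsuc (toℕ-injective (trans (toℕ-lower₁ (inject₁ i) n≢i) (toℕ-inject₁ i)))

unrotate-rotate : ∀ {n} (x : Fin (suc n)) → unrotate (rotate x) ≡ x
unrotate-rotate {n} x with n ≟ toℕ x
... | yes n≡x = toℕ-injective (trans (toℕ-fromℕ n) n≡x)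
... | no n≢x  = toℕ-injective (trans (toℕ-inject₁ (lower₁ x n≢x)) (toℕ-lower₁ x n≢x))

rotation : ∀ n → Perm (suc n)
rotation n = permutation rotate unrotate rotate-unrotate unrotate-rotate

rotate-step : ∀ {n} (j : Fin (suc n)) → toℕ j ≢ n → toℕ (rotate j) ≡ suc (toℕ j)
rotate-step {n} j j≢n with n ≟ toℕ j
... | yes n≡j = contradiction (sym n≡j) j≢n
... | no n≢j  = cong suc (toℕ-lower₁ j n≢j)

rotate-last : ∀ {n} (j : Fin (suc n)) → toℕ j ≡ n → rotate j ≡ 0F
rotate-last {n} j j≡n with n ≟ toℕ j
... | yes _   = refl
... | no n≢j  = contradiction (sym j≡n) n≢j

module Rotation (n : ℕ) where
  open Iterate (rotation n)

  iter-rotation : ∀ k a → toℕ a + k ≤ n → toℕ (iter (rotation n) k a) ≡ toℕ a + k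
  iter-rotation zero    a _  = sym (+-identityʳ (toℕ a))
  iter-rotation (suc k) a a+k<n = begin
    toℕ (rotate (iter (rotation n) k a))  ≡⟨ rotate-step _ not-last ⟩
    suc (toℕ (iter (rotation n) k a))     ≡⟨ cong suc previous ⟩
    suc (toℕ a + k)                       ≡⟨ +-suc (toℕ a) k ⟨
    toℕ a + suc k                         ∎
    where
      previous = iter-rotation k a (≤-trans (+-monoʳ-≤ (toℕ a) (n≤1+n k)) a+k<n)
      not-last : toℕ (iter (rotation n) k a) ≢ n
      not-last eq = <-irrefl (trans (sym previous) eq) (subst (_≤ n) (+-suc (toℕ a) k) a+k<n)

  iter-rotation-0 : ∀ b → iter (rotation n) (toℕ b) 0F ≡ b
  iter-rotation-0 b = toℕ-injective (iter-rotation (toℕ b) 0F (s≤s⁻¹ (toℕ<n b)))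

  rotation-wraps : ∀ a → iter (rotation n) (suc (n ∸ toℕ a)) a ≡ 0F
  rotation-wraps a = rotate-last _ (trans (iter-rotation (n ∸ toℕ a) a (≤-reflexive a+[n∸a]≡n)) a+[n∸a]≡n)
    where a+[n∸a]≡n = m+[n∸m]≡n (s≤s⁻¹ (toℕ<n a))

  rotation-isFullCycle : IsFullCycle (rotation n)
  rotation-isFullCycle a b = toℕ b + suc (n ∸ toℕ a) , (begin
    iter (rotation n) (toℕ b + suc (n ∸ toℕ a)) a                  ≡⟨ iter-+ (toℕ b) _ a ⟩
    iter (rotation n) (toℕ b) (iter (rotation n) (suc (n ∸ toℕ a)) a) ≡⟨ cong (iter (rotation n) (toℕ b)) (rotation-wraps a) ⟩
    iter (rotation n) (toℕ b) 0F                                  ≡⟨ iter-rotation-0 b ⟩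
    b                                                             ∎)

conjugate : ∀ {m} → Perm m → Perm m → Perm m
conjugate τ σ = flip τ ∘ₚ (σ ∘ₚ τ)

iter-conjugate : ∀ {m} (τ σ : Perm m) k x → iter (conjugate τ σ) k (τ ⟨$⟩ʳ x) ≡ τ ⟨$⟩ʳ iter σ k x
iter-conjugate τ σ zero    x = refl
iter-conjugate τ σ (suc k) x = begin
  conjugate τ σ ⟨$⟩ʳ iter (conjugate τ σ) k (τ ⟨$⟩ʳ x) ≡⟨ cong (conjugate τ σ ⟨$⟩ʳ_) (iter-conjugate τ σ k x) ⟩
  τ ⟨$⟩ʳ (σ ⟨$⟩ʳ (τ ⟨$⟩ˡ (τ ⟨$⟩ʳ iter σ k x)))        ≡⟨ cong (λ y → τ ⟨$⟩ʳ (σ ⟨$⟩ʳ y)) (inverseˡ τ) ⟩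
  τ ⟨$⟩ʳ iter σ (suc k) x                              ∎

conjugate-isFullCycle : ∀ {m} (τ σ : Perm m) → IsFullCycle σ → IsFullCycle (conjugate τ σ)
conjugate-isFullCycle τ σ full x y = k , (begin
  iter (conjugate τ σ) k x                    ≡⟨ cong (iter (conjugate τ σ) k) (inverseʳ τ) ⟨
  iter (conjugate τ σ) k (τ ⟨$⟩ʳ (τ ⟨$⟩ˡ x))  ≡⟨ iter-conjugate τ σ k (τ ⟨$⟩ˡ x) ⟩
  τ ⟨$⟩ʳ iter σ k (τ ⟨$⟩ˡ x)                  ≡⟨ cong (τ ⟨$⟩ʳ_) (proj₂ (full (τ ⟨$⟩ˡ x) (τ ⟨$⟩ˡ y))) ⟩
  τ ⟨$⟩ʳ (τ ⟨$⟩ˡ y)                           ≡⟨ inverseʳ τ ⟩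
  y                                           ∎)
  where k = proj₁ (full (τ ⟨$⟩ˡ x) (τ ⟨$⟩ˡ y))

-- The cycle with prescribed word σ: relabel the rotation by 0 ↦ 0,
-- t ↦ σ(n − t) + 1, so that its orbit of 0 is 0, σ(n−1)+1, …, σ(0)+1.
module CycleWithWord {n : ℕ} (σ : Perm n) where
  relabel : Perm (suc n)
  relabel = lift₀ (reverse ∘ₚ σ)

  cycle : Cycle (suc n)
  cycle = conjugate relabel (rotation n) ,
          conjugate-isFullCycle relabel (rotation n) (Rotation.rotation-isFullCycle n)

  F-cycle : F cycle ≈ₚ σ
  F-cycle k = fsuc-injective (begin
    fsuc (F cycle ⟨$⟩ʳ k)                                 ≡⟨ FullCycle.word-orbit (proj₁ cycle) (proj₂ cycle) k ⟩
    iter (proj₁ cycle) (n ∸ toℕ k) 0F                     ≡⟨ cong (λ t → iter (proj₁ cycle) t 0F) position ⟩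
    iter (proj₁ cycle) (toℕ t) (relabel ⟨$⟩ʳ 0F)          ≡⟨ iter-conjugate relabel (rotation n) (toℕ t) 0F ⟩
    relabel ⟨$⟩ʳ iter (rotation n) (toℕ t) 0F             ≡⟨ cong (relabel ⟨$⟩ʳ_) (Rotation.iter-rotation-0 n t) ⟩
    fsuc (σ ⟨$⟩ʳ opposite (opposite k))                   ≡⟨ cong (λ i → fsuc (σ ⟨$⟩ʳ i)) (opposite-involutive k) ⟩
    fsuc (σ ⟨$⟩ʳ k)                                       ∎)
    where
      t = fsuc (opposite k)
      position : n ∸ toℕ k ≡ toℕ t
      position = trans (cong (λ i → n ∸ toℕ i) (sym (opposite-involutive k))) (∸-opposite (opposite k))

F-bijection : ∀ n → Bijection (CycleSetoid (suc n)) (PermSetoid n)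
F-bijection n = record
  { to        = F
  ; cong      = λ {x} {y} → F-cong x y
  ; bijective = (λ {x} {y} → F-injective x y) , surjective
  }
  where
    surjective : ∀ σ → ∃ λ x → ∀ {z} → proj₁ z ≈ₚ proj₁ x → F z ≈ₚ σ
    surjective σ = cycle , λ {z} z≈cycle k → trans (F-cong z cycle z≈cycle k) (F-cycle k)
      where open CycleWithWord {n} σ

shift-interval : ∀ {m} (A : SubsetP (suc m)) (B : SubsetP m) → A 0F → (∀ v → B v ⇔ A (fsuc v)) →
  ∀ ℓ → (A ≐ Interval (suc ℓ)) ⇔ (B ≐ Interval ℓ)
shift-interval A B A0 B⇔A ℓ = mk⇔ restrict extend
  where
    interval-shift : ∀ {m} (v : Fin m) → Interval (suc ℓ) (fsuc v) ⇔ Interval ℓ v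
    interval-shift v = mk⇔ s≤s⁻¹ s≤s
    restrict : A ≐ Interval (suc ℓ) → B ≐ Interval ℓ
    restrict A≐ v = ⇔-trans (B⇔A v) (⇔-trans (A≐ (fsuc v)) (interval-shift v))
    extend : B ≐ Interval ℓ → A ≐ Interval (suc ℓ)
    extend B≐ 0F       = mk⇔ (λ _ → s≤s z≤n) (λ _ → A0)
    extend B≐ (fsuc v) = ⇔-trans (⇔-sym (B⇔A v)) (⇔-trans (B≐ v) (⇔-sym (interval-shift v)))

-- The theorem: for 1 ≤ ℓ ≤ n we have n ≥ 1, so 0 ∈ Exc(π) and shift-interval applies.
mainTheorem9 : (n : ℕ) →
    ∃ λ (F : Bijection (CycleSetoid (suc n)) (PermSetoid n)) →
      ∀ (π : Cycle (suc n)) (ℓ : ℕ) → 1 ≤ ℓ → ℓ ≤ n →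
        (Exc (proj₁ π) ≐ Interval ℓ) ⇔ (DesBot (Bijection.to F π) ≐ Interval (ℓ ∸ 1))
mainTheorem9 n = F-bijection n , excedances⇔descentBottoms
  where
    excedances⇔descentBottoms : ∀ (π : Cycle (suc n)) (ℓ : ℕ) → 1 ≤ ℓ → ℓ ≤ n →
      (Exc (proj₁ π) ≐ Interval ℓ) ⇔ (DesBot (F π) ≐ Interval (ℓ ∸ 1))
    excedances⇔descentBottoms (π , full) (suc ℓ) _ ℓ≤n =
      shift-interval (Exc π) (DesBot (F (π , full)))
        (exc-zero (≤-trans (s≤s z≤n) ℓ≤n)) desBot⇔exc ℓ
      where open FullCycle π full
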